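{- Let $G$ be a $2$-connected $2$-leaf-stable graph. Then $G$ has fault cost $\varphi(G)=1$ if and only if there exist vertices $a_1,a_2\in V(G)$ such that $G$ has a hamiltonian $a_1a_2$-path and, for every vertex $x\in V(G)\setminus\{a_1,a_2\}$, the graph $G-x$ also has a hamiltonian $a_1a_2$-path.
   Context: Graphs are finite, simple and undirected. A graph is hamiltonian if it has a cycle through all its vertices ($K_1,K_2$ are not); a hamiltonian $ab$-path is a path through all vertices with end-vertices $a,b$. The minimum leaf number ${\rm ml}(G)$ is $1$ if $G$ is hamiltonian, $\infty$ if $G$ is disconnected, and otherwise the minimum number of leaves of a spanning tree. $G$ is $2$-leaf-stable if ${\rm ml}(G)=2$ and ${\rm ml}(G-v)=2$ for every $v\in V(G)$. An ml-subgraph of $G$ is a hamiltonian cycle if $G$ is hamiltonian, and otherwise a spanning tree with ${\rm ml}(G)$ leaves; ${\cal S}_{\rm ml}(G)$ is the set of ml-subgraphs. For $S\in{\cal S}_{\rm ml}(G)$, $v\in V(G)$, $S_v\in{\cal S}_{\rm ml}(G-v)$, let $\tau(S,S_v)=|\{u\in V(G)\setminus\{v\}:\deg_S(u)\ne\deg_{S_v}(u)\}|$, $\varphi_S(G)=\max_{v}\min_{S_v\in{\cal S}_{\rm ml}(G-v)}\tau(S,S_v)$ and the fault cost $\varphi(G)=\min_{S\in{\cal S}_{\rm ml}(G)}\varphi_S(G)$. -}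

module Defs where

open import Data.Nat using (ℕ; zero; suc; _≤_; _≡ᵇ_)
open import Data.Bool using (Bool; true; false; T; if_then_else_; not)
open import Data.Fin using (Fin; punchIn)
open import Data.List using (List; []; _∷_; _∷ʳ_; _++_; map; length; allFin)
open import Data.Nat.ListAction using (sum)
open import Data.List.Relation.Unary.Linked using (Linked)
open import Data.List.Relation.Unary.Unique.Propositional using (Unique)
open import Data.List.Membership.Propositional using (_∈_)
open import Data.Product using (Σ; ∃; ∃-syntax; _×_; _,_)
open import Data.Sum using (_⊎_)
open import Relation.Nullary using (¬_)
open import Relation.Binary.PropositionalEquality using (_≡_; _≢_)
open import Function.Bundles using (_⇔_)

record Graph (n : ℕ) : Set where
  field
    adj   : Fin n → Fin n → Bool
    adj-sym : ∀ u w → adj u w ≡ adj w u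
    irref : ∀ u → adj u u ≡ false
open Graph public

Edge : ∀ {n} → (Fin n → Fin n → Bool) → Fin n → Fin n → Set
Edge S u w = T (S u w)

-- vertex deletion: G - v, vertex i of G - v is vertex (punchIn v i) of G
_─_ : ∀ {m} → Graph (suc m) → Fin (suc m) → Graph m
adj   (G ─ v) i j = adj G (punchIn v i) (punchIn v j)
adj-sym (G ─ v) i j = adj-sym G (punchIn v i) (punchIn v j)
irref (G ─ v) i   = irref G (punchIn v i)

Walk : ∀ {n} → (Fin n → Fin n → Bool) → Fin n → Fin n → Set
Walk S u w = u ≡ w ⊎ ∃[ xs ] Linked (Edge S) (u ∷ xs ∷ʳ w)

ConnectedRel : ∀ {n} → (Fin n → Fin n → Bool) → Set
ConnectedRel {n} S = ∀ (u w : Fin n) → Walk S u w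

Connected : ∀ {n} → Graph n → Set
Connected G = ConnectedRel (adj G)

HasCycle : ∀ {n} → (Fin n → Fin n → Bool) → Set
HasCycle S = ∃[ x ] ∃[ y ] ∃[ z ] ∃[ rest ]
  (Unique (x ∷ y ∷ z ∷ rest) × Linked (Edge S) ((x ∷ y ∷ z ∷ rest) ∷ʳ x))

-- 2-connected: more than 2 vertices, connected, and connected after deleting any vertex
TwoConnected : ∀ {m} → Graph (suc m) → Set
TwoConnected {m} G = 2 ≤ m × Connected G × (∀ v → Connected (G ─ v))

degree : ∀ {n} → (Fin n → Fin n → Bool) → Fin n → ℕ
degree {n} S v = sum (map (λ u → if S v u then 1 else 0) (allFin n))

leaves : ∀ {n} → (Fin n → Fin n → Bool) → ℕ
leaves {n} S = sum (map (λ v → if degree S v ≡ᵇ 1 then 1 else 0) (allFin n))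

data AdjIn {A : Set} : List A → A → A → Set where
  here  : ∀ {x y xs} → AdjIn (x ∷ y ∷ xs) x y
  there : ∀ {z x y xs} → AdjIn xs x y → AdjIn (z ∷ xs) x y

IsHamCycle : ∀ {n} → Graph n → (Fin n → Fin n → Bool) → Set
IsHamCycle {n} G S = 3 ≤ n × ∃[ x ] ∃[ rest ]
  ( Unique (x ∷ rest)
  × (∀ v → v ∈ (x ∷ rest))
  × Linked (Edge (adj G)) ((x ∷ rest) ∷ʳ x)
  × (∀ u w → Edge S u w ⇔ (AdjIn ((x ∷ rest) ∷ʳ x) u w ⊎ AdjIn ((x ∷ rest) ∷ʳ x) w u)))

Hamiltonian : ∀ {n} → Graph n → Set
Hamiltonian G = ∃[ S ] IsHamCycle G S

HamPath : ∀ {n} → Graph n → Fin n → Fin n → Set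
HamPath G a b = ∃[ mid ]
  ( Unique (a ∷ mid ∷ʳ b)
  × (∀ v → v ∈ (a ∷ mid ∷ʳ b))
  × Linked (Edge (adj G)) (a ∷ mid ∷ʳ b))

IsSpanningTree : ∀ {n} → Graph n → (Fin n → Fin n → Bool) → Set
IsSpanningTree G S =
    (∀ u w → S u w ≡ S w u)
  × (∀ u w → Edge S u w → Edge (adj G) u w)
  × ConnectedRel S
  × ¬ HasCycle S

-- ml(G) = 2 : G is not hamiltonian, and the minimum number of leaves of a
-- spanning tree of G is 2 (in particular G has a spanning tree, so is connected)
MLis2 : ∀ {n} → Graph n → Set
MLis2 G = ¬ Hamiltonian G
  × (∃[ T₀ ] (IsSpanningTree G T₀ × leaves T₀ ≡ 2))
  × (∀ T₁ → IsSpanningTree G T₁ → 2 ≤ leaves T₁)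

TwoLeafStable : ∀ {m} → Graph (suc m) → Set
TwoLeafStable G = MLis2 G × (∀ v → MLis2 (G ─ v))

IsMLSub : ∀ {n} → Graph n → (Fin n → Fin n → Bool) → Set
IsMLSub G S = IsHamCycle G S
  ⊎ (¬ Hamiltonian G × IsSpanningTree G S × (∀ T₁ → IsSpanningTree G T₁ → leaves S ≤ leaves T₁))

-- τ(S, S_v): number of vertices u ≠ v of G (u = punchIn v u') whose degree differs
τ : ∀ {m} → (Fin (suc m) → Fin (suc m) → Bool) → Fin (suc m) → (Fin m → Fin m → Bool) → ℕ
τ {m} S v Sv = sum (map (λ u' → if degree S (punchIn v u') ≡ᵇ degree Sv u' then 0 else 1) (allFin m))

IsMinOf : (ℕ → Set) → ℕ → Set
IsMinOf P k = P k × (∀ j → P j → k ≤ j)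

IsMaxOf : (ℕ → Set) → ℕ → Set
IsMaxOf P k = P k × (∀ j → P j → j ≤ k)

MinTau : ∀ {m} → Graph (suc m) → (Fin (suc m) → Fin (suc m) → Bool) → Fin (suc m) → ℕ → Set
MinTau G S v = IsMinOf (λ j → ∃[ Sv ] (IsMLSub (G ─ v) Sv × τ S v Sv ≡ j))

PhiS : ∀ {m} → Graph (suc m) → (Fin (suc m) → Fin (suc m) → Bool) → ℕ → Set
PhiS G S = IsMaxOf (λ j → ∃[ v ] MinTau G S v j)

FaultCost : ∀ {m} → Graph (suc m) → ℕ → Set
FaultCost G = IsMinOf (λ j → ∃[ S ] (IsMLSub G S × PhiS G S j))

-- Under ml(G) = 2 the ml-subgraphs of G and of every G − v are the spanning trees with exactly
-- two leaves, and such a tree is a hamiltonian path between its leaves: grow a path greedily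
-- from one leaf; a vertex of it with a neighbour off the path would start a branch ending in a
-- third leaf. Deleting a leaf v of such a tree S costs τ ≥ 1, since with all other degrees kept
-- S − v would have a single leaf. Deleting the first vertex a₁ of a hamiltonian a₁a₂-path costs
-- exactly 1 (only its neighbour becomes a leaf), and deleting x ∉ {a₁, a₂} costs 0 whenever G − x
-- has a hamiltonian a₁a₂-path; so φ(G) = 1. Conversely, if φ_S(G) = 1 and x is not a leaf of S,
-- some ml-subgraph of G − x differs from S in the degree of at most one vertex; both trees have
-- two leaves, so a single change cannot move a leaf, and G − x has a hamiltonian path with the
-- ends of S. The minima defining φ are only available under double negation, which suffices
-- because hamiltonian paths are decidable by enumeration.

{-# OPTIONS --safe #-}
module Submission where

open import Defs
open import Data.Bool using (Bool; true; false; T; not; if_then_else_)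
import Data.Bool.Properties as Bool
open import Data.Empty using (⊥; ⊥-elim)
open import Data.Fin using (Fin; zero; suc; punchIn; punchOut; _≟_)
open import Data.Fin.Properties
  using (punchInᵢ≢i; punchIn-injective; punchIn-punchOut; any?; all?; pigeonhole; <⇒≢)
open import Data.List
  using (List; []; _∷_; _∷ʳ_; _++_; map; length; reverse; lookup; allFin; tabulate; concatMap)
open import Data.List.Membership.Propositional using (_∈_; _∉_; lose)
open import Data.List.Membership.Propositional.Properties
  using (∈-++⁺ˡ; ∈-++⁺ʳ; ∈-++⁻; ∈-∃++; ∈-map⁺; ∈-map⁻; ∈-allFin; ∈-concat⁺′)
open import Data.List.Properties
  using (++-assoc; ∷-injective; map-++; map-cong; map-tabulate; length-map; length-++; unfold-reverse; reverse-++)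
open import Data.List.Relation.Unary.All as All using (All; []; _∷_)
open import Data.List.Relation.Unary.All.Properties using (¬Any⇒All¬)
import Data.List.Relation.Unary.All.Properties as All
open import Data.List.Relation.Unary.AllPairs using ([]; _∷_)
open import Data.List.Relation.Unary.Any as Any using (Any; here; there)
import Data.List.Relation.Unary.Any.Properties as Any
open import Data.List.Relation.Unary.First using () renaming (_++_∷_ to first-at)
open import Data.List.Relation.Unary.First.Properties using (cofirst?; toView; ¬First⇒All)
open import Data.List.Relation.Unary.Linked as Linked using (Linked; []; [-]; _∷_; linked?)
import Data.List.Relation.Unary.Linked.Properties as Linked
open import Data.List.Relation.Unary.Unique.Propositional using (Unique)
import Data.List.Relation.Unary.Unique.Propositional.Properties as Unique
open import Data.Nat using (ℕ; zero; suc; _+_; _≤_; _<_; z≤n; s≤s; _≡ᵇ_; _≤?_) renaming (_≟_ to _≟ℕ_)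
open import Data.Nat.Induction using (<-rec)
open import Data.Nat.ListAction using (sum)
open import Data.Nat.Properties
  using (module ≤-Reasoning; ≤-trans; ≤-antisym; ≤-reflexive; ≤⇒≯; ≰⇒>; <-irrefl; n≤1+n; m≤m+n;
         n≢0⇒n>0; +-mono-≤; +-cancelʳ-≡; +-suc; m+n≡0⇒m≡0; ≡ᵇ⇒≡; ≡⇒≡ᵇ; +-commutativeSemigroup)
open import Algebra.Properties.CommutativeSemigroup +-commutativeSemigroup using (x∙yz≈y∙xz)
open import Data.Product using (∃; ∃₂; ∃-syntax; _×_; _,_; proj₁; proj₂)
open import Data.Sum using (_⊎_; inj₁; inj₂; [_,_]′; swap)
open import Data.Unit using (tt)
open import Function using (_∘_; id)
open import Function.Bundles using (_⇔_; mk⇔; Equivalence)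
open import Relation.Binary.Construct.Closure.ReflexiveTransitive as Star using (Star; ε; _◅_; _◅◅_)
open import Relation.Binary.PropositionalEquality
  using (_≡_; _≢_; refl; sym; trans; cong; cong₂; subst; subst₂; module ≡-Reasoning)
open import Relation.Nullary using (¬_; Dec; yes; no; _×-dec_; _⊎-dec_; ¬?)
open import Relation.Nullary.Decidable
  using (T?; isYes; isYes≗does; does-⇔; toWitness; fromWitness; decidable-stable)
import Relation.Nullary.Decidable as Dec

module _ {n : ℕ} where
  open import Data.List.Membership.DecPropositional (_≟_ {n}) public using (_∈?_)
  open import Data.List.Relation.Unary.Unique.DecPropositional (_≟_ {n}) public using (unique?)

module _ {A : Set} where

  Unique-++⁻ˡ : ∀ (xs : List A) {ys} → Unique (xs ++ ys) → Unique xs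
  Unique-++⁻ˡ []       _         = []
  Unique-++⁻ˡ (x ∷ xs) (x∉ ∷ uq) = All.++⁻ˡ xs x∉ ∷ Unique-++⁻ˡ xs uq

  Unique-++⁻ʳ : ∀ (xs : List A) {ys} → Unique (xs ++ ys) → Unique ys
  Unique-++⁻ʳ []       uq       = uq
  Unique-++⁻ʳ (x ∷ xs) (_ ∷ uq) = Unique-++⁻ʳ xs uq

  Unique-++-disjoint : ∀ (xs : List A) {ys z} → Unique (xs ++ ys) → z ∈ xs → z ∉ ys
  Unique-++-disjoint (x ∷ xs) (x∉ ∷ _) (here refl)  z∈ys = All.lookup (All.++⁻ʳ xs x∉) z∈ys refl
  Unique-++-disjoint (x ∷ xs) (_ ∷ uq) (there z∈xs)      = Unique-++-disjoint xs uq z∈xs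

  Unique-prefix : ∀ (xs : List A) {y ys} → Unique (xs ++ y ∷ ys) → Unique (xs ∷ʳ y)
  Unique-prefix xs {y} {ys} uq = Unique-++⁻ˡ (xs ∷ʳ y) (subst Unique (sym (++-assoc xs (y ∷ []) ys)) uq)

  Unique-∷ʳ : ∀ {xs : List A} {x} → Unique xs → x ∉ xs → Unique (xs ∷ʳ x)
  Unique-∷ʳ uq x∉ = Unique.++⁺ uq ([] ∷ []) λ { (x∈ , here refl) → x∉ x∈ }

  Unique-reverse : ∀ {xs : List A} → Unique xs → Unique (reverse xs)
  Unique-reverse {[]}     _         = []
  Unique-reverse {x ∷ xs} (x∉ ∷ uq) = subst Unique (sym (unfold-reverse x xs))
    (Unique-∷ʳ (Unique-reverse uq) (λ x∈ → All.lookup x∉ (Any.reverse⁻ x∈) refl))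

  singleton≢++∷∷ : ∀ (xs : List A) {t v x : A} {ys} → t ∷ [] ≢ xs ++ v ∷ x ∷ ys
  singleton≢++∷∷ []          ()
  singleton≢++∷∷ (_ ∷ [])    ()
  singleton≢++∷∷ (_ ∷ _ ∷ _) ()

  ends-with : ∀ (xs : List A) {t x y : A} {rest} → t ∷ rest ≡ xs ++ x ∷ y ∷ [] →
    ∃ λ mid → rest ≡ mid ∷ʳ y
  ends-with []       eq = [] , proj₂ (∷-injective eq)
  ends-with (_ ∷ xs) {x = x} {y} eq =
    xs ∷ʳ x , trans (proj₂ (∷-injective eq)) (sym (++-assoc xs (x ∷ []) (y ∷ [])))

module _ {A : Set} {R : A → A → Set} where

  Linked-split : ∀ (xs : List A) {y ys} → Linked R (xs ++ y ∷ ys) → Linked R (xs ∷ʳ y) × Linked R (y ∷ ys)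
  Linked-split []            lk       = [-] , lk
  Linked-split (x ∷ [])      (r ∷ lk) = r ∷ [-] , lk
  Linked-split (x ∷ x′ ∷ xs) (r ∷ lk) = let front , back = Linked-split (x′ ∷ xs) lk in r ∷ front , back

  Linked-∷ʳ : ∀ (xs : List A) {y z} → Linked R (xs ∷ʳ y) → R y z → Linked R (xs ∷ʳ y ∷ʳ z)
  Linked-∷ʳ []            [-]        r = r ∷ [-]
  Linked-∷ʳ (x ∷ [])      (r′ ∷ [-]) r = r′ ∷ r ∷ [-]
  Linked-∷ʳ (x ∷ x′ ∷ xs) (r′ ∷ lk)  r = r′ ∷ Linked-∷ʳ (x′ ∷ xs) lk r

  Linked-reverse : (∀ {u w} → R u w → R w u) → ∀ {xs} → Linked R xs → Linked R (reverse xs)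
  Linked-reverse sym-R []                    = []
  Linked-reverse sym-R [-]                   = [-]
  Linked-reverse sym-R {x ∷ y ∷ ys} (r ∷ lk) =
    subst (Linked R) (sym (trans (unfold-reverse x (y ∷ ys)) (cong (_∷ʳ x) (unfold-reverse y ys))))
      (Linked-∷ʳ (reverse ys) (subst (Linked R) (unfold-reverse y ys) (Linked-reverse sym-R lk)) (sym-R r))

  Linked-restrict : ∀ {P : A → Set} {R′ : A → A → Set} → (∀ {u w} → P u → P w → R u w → R′ u w) →
    ∀ {xs} → All P xs → Linked R xs → Linked R′ xs
  Linked-restrict f _              []       = []
  Linked-restrict f _              [-]      = [-]
  Linked-restrict f (pu ∷ pw ∷ ps) (r ∷ lk) = f pu pw r ∷ Linked-restrict f (pw ∷ ps) lk

  Linked⇒Star : ∀ {x xs v} → Linked R (x ∷ xs) → v ∈ x ∷ xs → Star R x v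
  Linked⇒Star _        (here refl) = ε
  Linked⇒Star (r ∷ lk) (there v∈)  = r ◅ Linked⇒Star lk v∈

Star⇒Walk : ∀ {n} {S : Fin n → Fin n → Bool} {u w} → Star (Edge S) u w → Walk S u w
Star⇒Walk ε = inj₁ refl
Star⇒Walk (e ◅ s) with Star⇒Walk s
... | inj₁ refl      = inj₂ ([] , e ∷ [-])
... | inj₂ (xs , lk) = inj₂ (_ ∷ xs , e ∷ lk)

punchIn-cancel : ∀ {n} (v : Fin (suc n)) {u w z} → punchIn v u ≡ z → punchIn v w ≡ z → u ≡ w
punchIn-cancel v {u} {w} u↦z w↦z = punchIn-injective v u w (trans u↦z (sym w↦z))

punchIn-≢ : ∀ {n} (v : Fin (suc n)) {u a′ a} → punchIn v a′ ≡ a → u ≢ a′ → punchIn v u ≢ a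
punchIn-≢ v a′↦a u≢a′ u↦a = u≢a′ (punchIn-cancel v u↦a a′↦a)

∉⇒map-punchIn : ∀ {n} (v : Fin (suc n)) xs → v ∉ xs → ∃ λ xs′ → map (punchIn v) xs′ ≡ xs
∉⇒map-punchIn v []       _  = [] , refl
∉⇒map-punchIn v (x ∷ xs) v∉ =
  let xs′ , eq = ∉⇒map-punchIn v xs (v∉ ∘ there)
  in  punchOut (v∉ ∘ here) ∷ xs′ , cong₂ _∷_ (punchIn-punchOut (v∉ ∘ here)) eq

covering-length : ∀ {n} {xs : List (Fin n)} → (∀ v → v ∈ xs) → n ≤ length xs
covering-length {n} {xs} covers with n ≤? length xs
... | yes n≤ = n≤
... | no  n≰ with pigeonhole (≰⇒> n≰) (Any.index ∘ covers)
...   | i , j , i<j , same-index = ⊥-elim (<⇒≢ i<j (begin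
  i                                  ≡⟨ Any.lookup-index (covers i) ⟩
  lookup xs (Any.index (covers i))   ≡⟨ cong (lookup xs) same-index ⟩
  lookup xs (Any.index (covers j))   ≡⟨ Any.lookup-index (covers j) ⟨
  j                                  ∎))
  where open ≡-Reasoning

bit : Bool → ℕ
bit b = if b then 1 else 0

count : ∀ {n} → (Fin n → Bool) → ℕ
count {zero}  f = 0
count {suc n} f = bit (f zero) + count (f ∘ suc)

sum-bits≡count : ∀ {n} (f : Fin n → Bool) → sum (map (bit ∘ f) (allFin n)) ≡ count f
sum-bits≡count f = trans (cong sum (map-tabulate id (bit ∘ f))) (sum-tabulate f)
  where
  sum-tabulate : ∀ {n} (f : Fin n → Bool) → sum (tabulate (bit ∘ f)) ≡ count f
  sum-tabulate {zero}  f = refl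
  sum-tabulate {suc n} f = cong (bit (f zero) +_) (sum-tabulate (f ∘ suc))

bit-true : ∀ {b} → T b → bit b ≡ 1
bit-true {true} _ = refl

bit-false : ∀ {b} → ¬ T b → bit b ≡ 0
bit-false {false} _  = refl
bit-false {true}  ¬t = ⊥-elim (¬t tt)

T-injective : ∀ {a b} → (T a → T b) → (T b → T a) → a ≡ b
T-injective {false} {false} _  _  = refl
T-injective {false} {true}  _  ba = ⊥-elim (ba tt)
T-injective {true}  {false} ab _  = ⊥-elim (ab tt)
T-injective {true}  {true}  _  _  = refl

count-cong : ∀ {n} {f g : Fin n → Bool} → (∀ u → f u ≡ g u) → count f ≡ count g
count-cong {zero}  f≗g = refl
count-cong {suc n} f≗g = cong₂ _+_ (cong bit (f≗g zero)) (count-cong (f≗g ∘ suc))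

count≤n : ∀ {n} (f : Fin n → Bool) → count f ≤ n
count≤n {zero}  f = z≤n
count≤n {suc n} f = +-mono-≤ (bit≤1 (f zero)) (count≤n (f ∘ suc))
  where
  bit≤1 : ∀ b → bit b ≤ 1
  bit≤1 true  = s≤s z≤n
  bit≤1 false = z≤n

count-false : ∀ {n} {f : Fin n → Bool} → (∀ u → ¬ T (f u)) → count f ≡ 0
count-false {zero}  none = refl
count-false {suc n} none = cong₂ _+_ (bit-false (none zero)) (count-false (none ∘ suc))

count-punchIn : ∀ {n} (f : Fin (suc n) → Bool) v → count f ≡ bit (f v) + count (f ∘ punchIn v)
count-punchIn         f zero    = refl
count-punchIn {suc n} f (suc v) =
  trans (cong (bit (f zero) +_) (count-punchIn (f ∘ suc) v)) (x∙yz≈y∙xz (bit (f zero)) (bit (f (suc v))) _)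

count-insert : ∀ {n} {f g : Fin n → Bool} {x} → T (f x) → ¬ T (g x) → (∀ u → u ≢ x → f u ≡ g u) →
  count f ≡ suc (count g)
count-insert {suc n} {f} {g} {x} fx ¬gx f≗g = begin
  count f                                  ≡⟨ count-punchIn f x ⟩
  bit (f x) + count (f ∘ punchIn x)        ≡⟨ cong₂ _+_ (bit-true fx) (count-cong (f≗g _ ∘ punchInᵢ≢i x)) ⟩
  suc (count (g ∘ punchIn x))              ≡⟨ cong (λ b → suc (b + count (g ∘ punchIn x))) (bit-false ¬gx) ⟨
  suc (bit (g x) + count (g ∘ punchIn x))  ≡⟨ cong suc (count-punchIn g x) ⟨
  suc (count g)                            ∎
  where open ≡-Reasoning

count-point : ∀ {n} {f : Fin n → Bool} {x} → T (f x) → (∀ u → u ≢ x → ¬ T (f u)) → count f ≡ 1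
count-point {suc n} {f} {x} fx others = begin
  count f                            ≡⟨ count-punchIn f x ⟩
  bit (f x) + count (f ∘ punchIn x)  ≡⟨ cong₂ _+_ (bit-true fx) (count-false (others _ ∘ punchInᵢ≢i x)) ⟩
  1                                  ∎
  where open ≡-Reasoning

count-pair : ∀ {n} {f : Fin n → Bool} {x y} → x ≢ y → T (f x) → T (f y) →
  (∀ u → u ≢ x → u ≢ y → ¬ T (f u)) → count f ≡ 2
count-pair {f = f} {x} {y} x≢y fx fy others = begin
  count f           ≡⟨ count-insert {g = is-y} fx (x≢y ∘ toWitness) agree ⟩
  suc (count is-y)  ≡⟨ cong suc (count-point {f = is-y} (fromWitness refl) (λ u u≢y → u≢y ∘ toWitness)) ⟩
  2                 ∎
  where
  open ≡-Reasoning
  is-y : Fin _ → Bool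
  is-y u = isYes (u ≟ y)
  agree : ∀ u → u ≢ x → f u ≡ is-y u
  agree u u≢x = T-injective (λ fu → fromWitness (decidable-stable (u ≟ y) (λ u≢y → others u u≢x u≢y fu)))
                            (λ u≡y → subst (T ∘ f) (sym (toWitness u≡y)) fy)

count≡0 : ∀ {n} {f : Fin n → Bool} → count f ≡ 0 → ∀ u → ¬ T (f u)
count≡0 {suc n} {f} zero-count u fu =
  0≢1 (trans (sym (m+n≡0⇒m≡0 (bit (f u)) (trans (sym (count-punchIn f u)) zero-count))) (bit-true fu))
  where
  0≢1 : 0 ≢ 1
  0≢1 ()

count>0 : ∀ {n} {f : Fin n → Bool} → 0 < count f → ∃ λ u → T (f u)
count>0 {suc n} {f} positive with f zero in f0
... | true  = zero , subst T (sym f0) tt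
... | false = let u , fu = count>0 {f = f ∘ suc} positive in suc u , fu

length≤count : ∀ {n} {f : Fin n → Bool} {xs} → Unique xs → (∀ {u} → u ∈ xs → T (f u)) →
  length xs ≤ count f
length≤count {xs = []} _ _ = z≤n
length≤count {zero} {xs = () ∷ _}
length≤count {suc n} {f} {x ∷ xs} uq@(_ ∷ uq′) inF with ∉⇒map-punchIn x xs (Unique.Unique[x∷xs]⇒x∉xs uq)
... | xs′ , refl = begin
  suc (length (map (punchIn x) xs′))  ≡⟨ cong suc (length-map (punchIn x) xs′) ⟩
  suc (length xs′)                    ≤⟨ s≤s (length≤count (Unique.map⁻ uq′) (inF ∘ there ∘ ∈-map⁺ _)) ⟩
  suc (count (f ∘ punchIn x))         ≡⟨ cong (_+ count (f ∘ punchIn x)) (bit-true (inF (here refl))) ⟨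
  bit (f x) + count (f ∘ punchIn x)   ≡⟨ count-punchIn f x ⟨
  count f                             ∎
  where open ≤-Reasoning

length≤n : ∀ {n} {xs : List (Fin n)} → Unique xs → length xs ≤ n
length≤n uq = ≤-trans (length≤count {f = λ _ → true} uq _) (count≤n _)

count≤1⇒unique : ∀ {n} {f : Fin n → Bool} → count f ≤ 1 → ∀ {u w} → T (f u) → T (f w) → u ≡ w
count≤1⇒unique {f = f} at-most-one {u} {w} fu fw with u ≟ w
... | yes u≡w = u≡w
... | no  u≢w = ⊥-elim (2≰1 (≤-trans (length≤count {f = f} ((u≢w ∷ []) ∷ [] ∷ []) members) at-most-one))
  where
  2≰1 : ¬ 2 ≤ 1
  2≰1 (s≤s ())
  members : ∀ {v} → v ∈ u ∷ w ∷ [] → T (f v)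
  members (here refl)         = fu
  members (there (here refl)) = fw

count-agree : ∀ {n} {f g : Fin n → Bool} {u} → count f ≡ count g → (∀ w → w ≢ u → f w ≡ g w) → f u ≡ g u
count-agree {suc n} {f} {g} {u} same f≗g = bit-injective (+-cancelʳ-≡ _ _ _ (begin
  bit (f u) + count (f ∘ punchIn u)  ≡⟨ count-punchIn f u ⟨
  count f                            ≡⟨ same ⟩
  count g                            ≡⟨ count-punchIn g u ⟩
  bit (g u) + count (g ∘ punchIn u)  ≡⟨ cong (bit (g u) +_) (count-cong (f≗g _ ∘ punchInᵢ≢i u)) ⟨
  bit (g u) + count (f ∘ punchIn u)  ∎))
  where
  open ≡-Reasoning
  bit-injective : ∀ {a b} → bit a ≡ bit b → a ≡ b
  bit-injective {false} {false} _ = refl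
  bit-injective {true}  {true}  _ = refl

same-count-one-difference⇒≗ : ∀ {n} {f g D : Fin n → Bool} → count f ≡ count g → count D ≤ 1 →
  (∀ u → f u ≢ g u → T (D u)) → ∀ u → f u ≡ g u
same-count-one-difference⇒≗ {f = f} {g} same D≤1 marked u with f u Bool.≟ g u
... | yes fu≡gu = fu≡gu
... | no  fu≢gu = ⊥-elim (fu≢gu (count-agree same agree-off-u))
  where
  agree-off-u : ∀ w → w ≢ u → f w ≡ g w
  agree-off-u w w≢u = decidable-stable (f w Bool.≟ g w)
    (λ fw≢gw → w≢u (count≤1⇒unique D≤1 (marked w fw≢gw) (marked u fu≢gu)))

-- The edge set of a path

module _ {A : Set} where

  AdjIn⇒∈ˡ : ∀ {l : List A} {u w} → AdjIn l u w → u ∈ l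
  AdjIn⇒∈ˡ here      = here refl
  AdjIn⇒∈ˡ (there p) = there (AdjIn⇒∈ˡ p)

  AdjIn⇒∈ʳ : ∀ {l : List A} {u w} → AdjIn l u w → w ∈ l
  AdjIn⇒∈ʳ here      = there (here refl)
  AdjIn⇒∈ʳ (there p) = there (AdjIn⇒∈ʳ p)

  Linked-AdjIn : ∀ (l : List A) → Linked (AdjIn l) l
  Linked-AdjIn []           = []
  Linked-AdjIn (x ∷ [])     = [-]
  Linked-AdjIn (x ∷ y ∷ xs) = here ∷ Linked.map there (Linked-AdjIn (y ∷ xs))

  Linked⇒AdjIn : ∀ {R : A → A → Set} {l} → Linked R l → ∀ {u w} → AdjIn l u w → R u w
  Linked⇒AdjIn (r ∷ _)  here      = r
  Linked⇒AdjIn (_ ∷ lk) (there p) = Linked⇒AdjIn lk p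

  Adjacent : List A → A → A → Set
  Adjacent l u w = AdjIn l u w ⊎ AdjIn l w u

  Adjacent-∈ : ∀ {l u w} → Adjacent l u w → u ∈ l
  Adjacent-∈ (inj₁ p) = AdjIn⇒∈ˡ p
  Adjacent-∈ (inj₂ p) = AdjIn⇒∈ʳ p

  Adjacent-there : ∀ {x y xs u w} → Adjacent (y ∷ xs) u w → Adjacent (x ∷ y ∷ xs) u w
  Adjacent-there (inj₁ p) = inj₁ (there p)
  Adjacent-there (inj₂ p) = inj₂ (there p)

  Adjacent-drop : ∀ {x y xs u w} → Adjacent (x ∷ y ∷ xs) u w → ¬ (u ≡ x × w ≡ y) → ¬ (u ≡ y × w ≡ x) →
    Adjacent (y ∷ xs) u w
  Adjacent-drop (inj₁ here)      ¬xy _   = ⊥-elim (¬xy (refl , refl))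
  Adjacent-drop (inj₁ (there p)) _   _   = inj₁ p
  Adjacent-drop (inj₂ here)      _   ¬yx = ⊥-elim (¬yx (refl , refl))
  Adjacent-drop (inj₂ (there p)) _   _   = inj₂ p

adjIn? : ∀ {n} (l : List (Fin n)) u w → Dec (AdjIn l u w)
adjIn? []           u w = no λ ()
adjIn? (x ∷ [])     u w = no λ { (there ()) }
adjIn? (x ∷ y ∷ xs) u w = Dec.map′ (λ { (inj₁ (refl , refl)) → here ; (inj₂ p) → there p })
                                   (λ { here → inj₁ (refl , refl) ; (there p) → inj₂ p })
                                   ((u ≟ x ×-dec w ≟ y) ⊎-dec adjIn? (y ∷ xs) u w)

pathEdges : ∀ {n} → List (Fin n) → Fin n → Fin n → Bool
pathEdges l u w = isYes (adjIn? l u w ⊎-dec adjIn? l w u)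

module _ {n} {l : List (Fin n)} where

  pathEdges⇒Adjacent : ∀ {u w} → Edge (pathEdges l) u w → Adjacent l u w
  pathEdges⇒Adjacent = toWitness

  Adjacent⇒pathEdges : ∀ {u w} → Adjacent l u w → Edge (pathEdges l) u w
  Adjacent⇒pathEdges = fromWitness

  pathEdges-sym : ∀ u w → pathEdges l u w ≡ pathEdges l w u
  pathEdges-sym u w = begin
    isYes uw?     ≡⟨ isYes≗does uw? ⟩
    Dec.does uw?  ≡⟨ does-⇔ (mk⇔ swap swap) uw? wu? ⟩
    Dec.does wu?  ≡⟨ isYes≗does wu? ⟨
    isYes wu?     ∎
    where
    open ≡-Reasoning
    uw? = adjIn? l u w ⊎-dec adjIn? l w u
    wu? = adjIn? l w u ⊎-dec adjIn? l u w

  pathEdges-symmetric : ∀ {u w} → Edge (pathEdges l) u w → Edge (pathEdges l) w u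
  pathEdges-symmetric {u} {w} = subst T (pathEdges-sym u w)

  pathEdges-sub : ∀ {R : Fin n → Fin n → Set} → (∀ {u w} → R u w → R w u) → Linked R l →
    ∀ {u w} → Edge (pathEdges l) u w → R u w
  pathEdges-sub sym-R lk e with pathEdges⇒Adjacent e
  ... | inj₁ p = Linked⇒AdjIn lk p
  ... | inj₂ p = sym-R (Linked⇒AdjIn lk p)

pathEdges-connected : ∀ {n} {x} {xs : List (Fin n)} → (∀ v → v ∈ x ∷ xs) → ConnectedRel (pathEdges (x ∷ xs))
pathEdges-connected {x = x} {xs} covers u w = Star⇒Walk (Star.reverse pathEdges-symmetric (from-x u) ◅◅ from-x w)
  where
  from-x : ∀ v → Star (Edge (pathEdges (x ∷ xs))) x v
  from-x v = Linked⇒Star (Linked.map (Adjacent⇒pathEdges ∘ inj₁) (Linked-AdjIn (x ∷ xs))) (covers v)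

degree≡count : ∀ {n} (S : Fin n → Fin n → Bool) v → degree S v ≡ count (S v)
degree≡count S v = sum-bits≡count (S v)

module _ {n} {x y : Fin n} {xs : List (Fin n)} (x∉ : x ∉ y ∷ xs) where
  private
    Sₗ = pathEdges (x ∷ y ∷ xs)
    Sᵣ = pathEdges (y ∷ xs)
    x≢y : x ≢ y
    x≢y = x∉ ∘ here

  first-neighbour : ∀ {w} → Edge Sₗ x w → w ≡ y
  first-neighbour e with pathEdges⇒Adjacent e
  ... | inj₁ here      = refl
  ... | inj₁ (there p) = ⊥-elim (x∉ (AdjIn⇒∈ˡ p))
  ... | inj₂ here      = ⊥-elim (x∉ (here refl))
  ... | inj₂ (there p) = ⊥-elim (x∉ (AdjIn⇒∈ʳ p))

  degree-first : degree Sₗ x ≡ 1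
  degree-first = trans (degree≡count Sₗ x)
    (count-point (Adjacent⇒pathEdges (inj₁ here)) (λ w w≢y → w≢y ∘ first-neighbour))

  degree-second : degree Sₗ y ≡ suc (degree Sᵣ y)
  degree-second = trans (degree≡count Sₗ y)
    (trans (count-insert {f = Sₗ y} {g = Sᵣ y} {x = x} yx ¬yx agree) (cong suc (sym (degree≡count Sᵣ y))))
    where
    yx : Edge Sₗ y x
    yx = Adjacent⇒pathEdges (inj₂ here)
    ¬yx : ¬ Edge Sᵣ y x
    ¬yx = x∉ ∘ Adjacent-∈ ∘ swap ∘ pathEdges⇒Adjacent
    agree : ∀ w → w ≢ x → Sₗ y w ≡ Sᵣ y w
    agree w w≢x = T-injective
      (λ e → Adjacent⇒pathEdges (Adjacent-drop (pathEdges⇒Adjacent e) (x≢y ∘ sym ∘ proj₁) (w≢x ∘ proj₂)))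
      (Adjacent⇒pathEdges ∘ Adjacent-there ∘ pathEdges⇒Adjacent)

  degree-later : ∀ {u} → u ≢ x → u ≢ y → degree Sₗ u ≡ degree Sᵣ u
  degree-later {u} u≢x u≢y = trans (degree≡count Sₗ u) (trans (count-cong agree) (sym (degree≡count Sᵣ u)))
    where
    agree : ∀ w → Sₗ u w ≡ Sᵣ u w
    agree w = T-injective
      (λ e → Adjacent⇒pathEdges (Adjacent-drop (pathEdges⇒Adjacent e) (u≢x ∘ proj₁) (u≢y ∘ proj₁)))
      (Adjacent⇒pathEdges ∘ Adjacent-there ∘ pathEdges⇒Adjacent)

degree-singleton : ∀ {n} (b u : Fin n) → degree (pathEdges (b ∷ [])) u ≡ 0
degree-singleton b u = trans (degree≡count (pathEdges (b ∷ [])) u)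
  (count-false {f = pathEdges (b ∷ []) u} (λ w e → no-edge {w} (pathEdges⇒Adjacent {l = b ∷ []} e)))
  where
  no-edge : ∀ {w} → ¬ Adjacent (b ∷ []) u w
  no-edge (inj₁ (there ()))
  no-edge (inj₂ (there ()))

record PathDegrees {n} (a : Fin n) (mid : List (Fin n)) (b : Fin n) : Set where
  field
    start : degree (pathEdges (a ∷ mid ∷ʳ b)) a ≡ 1
    end   : degree (pathEdges (a ∷ mid ∷ʳ b)) b ≡ 1
    inner : ∀ {u} → u ∈ mid → degree (pathEdges (a ∷ mid ∷ʳ b)) u ≡ 2

path-degrees : ∀ {n} (a : Fin n) mid b → Unique (a ∷ mid ∷ʳ b) → PathDegrees a mid b
path-degrees a [] b uq = record
  { start = degree-first a∉
  ; end   = trans (degree-second a∉) (cong suc (degree-singleton b b))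
  ; inner = λ ()
  }
  where
  a∉ = Unique.Unique[x∷xs]⇒x∉xs uq
path-degrees a (m ∷ mid) b uq@(_ ∷ uq′) = record
  { start = degree-first a∉
  ; end   = trans (degree-later a∉ (not-a b∈) (not-m b∈)) end
  ; inner = λ { (here refl) → trans (degree-second a∉) (cong suc start)
              ; (there u∈)  → trans (degree-later a∉ (not-a (∈-++⁺ˡ u∈)) (not-m (∈-++⁺ˡ u∈))) (inner u∈) }
  }
  where
  open PathDegrees (path-degrees m mid b uq′)
  a∉ = Unique.Unique[x∷xs]⇒x∉xs uq
  b∈ : b ∈ mid ∷ʳ b
  b∈ = ∈-++⁺ʳ mid (here refl)
  not-a : ∀ {u} → u ∈ mid ∷ʳ b → u ≢ a
  not-a u∈ refl = a∉ (there u∈)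
  not-m : ∀ {u} → u ∈ mid ∷ʳ b → u ≢ m
  not-m u∈ refl = Unique.Unique[x∷xs]⇒x∉xs uq′ u∈

module _ {A : Set} {R : A → A → Set} where

  successor : ∀ (x : A) Q c₀ → Linked R (x ∷ Q ∷ʳ c₀) →
    ∃ λ s → R x s × (s ∈ Q ⊎ s ≡ c₀ × Q ≡ [])
  successor x []      c₀ (r ∷ _) = c₀ , r , inj₂ (refl , refl)
  successor x (q ∷ Q) c₀ (r ∷ _) = q , r , inj₁ (here refl)

  predecessor : ∀ (c₀ : A) P x → Linked R (c₀ ∷ P ∷ʳ x) →
    ∃ λ p → R p x × (p ∈ P ⊎ p ≡ c₀ × P ≡ [])
  predecessor c₀ []      x (r ∷ _)  = c₀ , r , inj₂ (refl , refl)
  predecessor c₀ (q ∷ P) x (_ ∷ lk) with predecessor q P x lk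
  ... | p , r , inj₁ p∈P           = p , r , inj₁ (there p∈P)
  ... | p , r , inj₂ (refl , refl) = p , r , inj₁ (here refl)

  -- its predecessor and successor on the cycle would both be y
  pendant-vertex-off-cycle : ∀ {c₀ cs x y} → Unique (c₀ ∷ cs) → Linked R (c₀ ∷ cs ∷ʳ c₀) →
    2 ≤ length cs → x ∈ c₀ ∷ cs → (∀ {w} → R x w → w ≡ y) → (∀ {w} → R w x → w ≡ y) → ⊥
  pendant-vertex-off-cycle {cs = _ ∷ []} _ _ (s≤s ()) (here refl) _ _
  pendant-vertex-off-cycle {c₀} {c₁ ∷ c₂ ∷ rest} (_ ∷ c₁∉ ∷ _) (r ∷ lk) _ (here refl) out in′
    with predecessor c₁ (c₂ ∷ rest) c₀ lk
  ... | p , rp , inj₁ p∈ = All.lookup c₁∉ (subst (_∈ c₂ ∷ rest) (trans (in′ rp) (sym (out r))) p∈) refl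
  pendant-vertex-off-cycle {c₀} {cs} uq lk long (there x∈cs) out in′ with ∈-∃++ x∈cs
  ... | P , Q , refl
    with Linked-split (c₀ ∷ P) (subst (Linked R) (cong (c₀ ∷_) (++-assoc P (_ ∷ Q) (c₀ ∷ []))) lk)
  ... | before , after with predecessor c₀ P _ before | successor _ Q c₀ after
  ... | p , rp , inj₁ p∈P | s , rs , inj₁ s∈Q =
    Unique-++-disjoint P (Unique-++⁻ʳ (c₀ ∷ []) uq) p∈P
      (there (subst (_∈ Q) (trans (out rs) (sym (in′ rp))) s∈Q))
  ... | p , rp , inj₁ p∈P | s , rs , inj₂ (refl , _) =
    Unique.Unique[x∷xs]⇒x∉xs uq (∈-++⁺ˡ (subst (_∈ P) (trans (in′ rp) (sym (out rs))) p∈P))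
  ... | p , rp , inj₂ (refl , _) | s , rs , inj₁ s∈Q =
    Unique.Unique[x∷xs]⇒x∉xs uq (∈-++⁺ʳ P (there (subst (_∈ Q) (trans (out rs) (sym (in′ rp))) s∈Q)))
  ... | _ , _ , inj₂ (_ , refl) | _ , _ , inj₂ (_ , refl) with long
  ...   | s≤s ()

pathEdges-acyclic : ∀ {n} {l : List (Fin n)} → Unique l → ¬ HasCycle (pathEdges l)
pathEdges-acyclic {l = []}     _ (_ , _ , _ , _ , _ , () ∷ _)
pathEdges-acyclic {l = x ∷ []} _ (_ , _ , _ , _ , _ , () ∷ _)
pathEdges-acyclic {l = x ∷ y ∷ xs} uq@(_ ∷ uq′) (c₀ , c₁ , c₂ , rest , uqC , lk)
  with x ∈? (c₀ ∷ c₁ ∷ c₂ ∷ rest)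
... | yes x∈C = pendant-vertex-off-cycle uqC lk (s≤s (s≤s z≤n)) x∈C (first-neighbour x∉)
                  (first-neighbour x∉ ∘ pathEdges-symmetric {l = x ∷ y ∷ xs})
  where
  x∉ = Unique.Unique[x∷xs]⇒x∉xs uq
... | no  x∉C =
  pathEdges-acyclic uq′ (c₀ , c₁ , c₂ , rest , uqC , Linked-restrict drop (All.tabulate avoids-x) lk)
  where
  C = c₀ ∷ c₁ ∷ c₂ ∷ rest
  avoids-x : ∀ {z} → z ∈ C ∷ʳ c₀ → z ≢ x
  avoids-x z∈ refl with ∈-++⁻ C z∈
  ... | inj₁ x∈C         = x∉C x∈C
  ... | inj₂ (here refl) = x∉C (here refl)
  drop : ∀ {u w} → u ≢ x → w ≢ x → Edge (pathEdges (x ∷ y ∷ xs)) u w → Edge (pathEdges (y ∷ xs)) u w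
  drop u≢x w≢x e = Adjacent⇒pathEdges (Adjacent-drop (pathEdges⇒Adjacent e) (u≢x ∘ proj₁) (w≢x ∘ proj₂))

-- Trees with two leaves

IsLeaf : ∀ {n} → (Fin n → Fin n → Bool) → Fin n → Set
IsLeaf S v = degree S v ≡ 1

leaves≡count : ∀ {n} (S : Fin n → Fin n → Bool) → leaves S ≡ count (λ v → degree S v ≡ᵇ 1)
leaves≡count S = sum-bits≡count (λ v → degree S v ≡ᵇ 1)

module _ {n} {S : Fin n → Fin n → Bool} (two-leaves : leaves S ≡ 2) where

  no-three-leaves : ∀ {x y z} → x ≢ y → x ≢ z → y ≢ z → IsLeaf S x → IsLeaf S y → IsLeaf S z → ⊥
  no-three-leaves {x} {y} {z} x≢y x≢z y≢z x-leaf y-leaf z-leaf =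
    3≰2 (subst (3 ≤_) (trans (sym (leaves≡count S)) two-leaves) (length≤count uq leaf))
    where
    3≰2 : ¬ 3 ≤ 2
    3≰2 (s≤s (s≤s ()))
    uq : Unique (x ∷ y ∷ z ∷ [])
    uq = (x≢y ∷ x≢z ∷ []) ∷ (y≢z ∷ []) ∷ [] ∷ []
    leaf : ∀ {v} → v ∈ x ∷ y ∷ z ∷ [] → T (degree S v ≡ᵇ 1)
    leaf (here refl)                 = ≡⇒≡ᵇ _ 1 x-leaf
    leaf (there (here refl))         = ≡⇒≡ᵇ _ 1 y-leaf
    leaf (there (there (here refl))) = ≡⇒≡ᵇ _ 1 z-leaf

  leaf-of-two : ∀ {a b u} → a ≢ b → IsLeaf S a → IsLeaf S b → IsLeaf S u → u ≡ a ⊎ u ≡ b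
  leaf-of-two {a} {b} {u} a≢b a-leaf b-leaf u-leaf with u ≟ a | u ≟ b
  ... | yes u≡a | _       = inj₁ u≡a
  ... | no  _   | yes u≡b = inj₂ u≡b
  ... | no  u≢a | no  u≢b = ⊥-elim (no-three-leaves a≢b (u≢a ∘ sym) (u≢b ∘ sym) a-leaf b-leaf u-leaf)

  some-leaf : ∃ (IsLeaf S)
  some-leaf =
    let a , a-leaf = count>0 (subst (0 <_) (trans (sym two-leaves) (leaves≡count S)) (s≤s z≤n))
    in  a , ≡ᵇ⇒≡ _ 1 a-leaf

leaf-neighbour : ∀ {n} {S : Fin n → Fin n → Bool} {a} → IsLeaf S a → ∃ (Edge S a)
leaf-neighbour {S = S} {a} a-leaf = count>0 (subst (0 <_) (trans (sym a-leaf) (degree≡count S a)) (s≤s z≤n))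

SpanningPath : ∀ {n} → (Fin n → Fin n → Set) → Fin n → Fin n → Set
SpanningPath R a b =
  ∃ λ mid → Unique (a ∷ mid ∷ʳ b) × (∀ v → v ∈ a ∷ mid ∷ʳ b) × Linked R (a ∷ mid ∷ʳ b)

module AcyclicGraph {n} (S : Fin n → Fin n → Bool)
  (symmetric : ∀ {u w} → Edge S u w → Edge S w u) (irreflexive : ∀ {u} → ¬ Edge S u u)
  (acyclic : ¬ HasCycle S) where

  private
    E = Edge S

  no-closing-edge : ∀ x y zs {w} → Unique (x ∷ y ∷ zs ∷ʳ w) → Linked E (x ∷ y ∷ zs ∷ʳ w) → ¬ E w x
  no-closing-edge x y []       uq lk e = acyclic (x , y , _ , [] , uq , Linked-∷ʳ (x ∷ y ∷ []) lk e)
  no-closing-edge x y (z ∷ zs) uq lk e = acyclic (x , y , z , zs ∷ʳ _ , uq , Linked-∷ʳ (x ∷ y ∷ z ∷ zs) lk e)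

  stuck-tip-is-leaf : ∀ {c} rest → rest ≢ [] → Unique (c ∷ rest) → Linked E (c ∷ rest) →
    (∀ {w} → E c w → w ∈ rest) → IsLeaf S c
  stuck-tip-is-leaf []      nonempty = ⊥-elim (nonempty refl)
  stuck-tip-is-leaf {c} (d ∷ R) _ uq lk@(cd ∷ _) stuck = trans (degree≡count S c) (count-point cd only-d)
    where
    only-d : ∀ w → w ≢ d → ¬ E c w
    only-d w w≢d cw with stuck cw
    ... | here w≡d  = w≢d w≡d
    ... | there w∈R with ∈-∃++ w∈R
    ...   | R₁ , R₂ , refl =
      no-closing-edge c d R₁ (Unique-prefix (c ∷ d ∷ R₁) uq) (proj₁ (Linked-split (c ∷ d ∷ R₁) lk))
        (symmetric cw)

  -- the outcome of greedily prolonging the path v ∷ L at its head by vertices outside F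
  record Extension (v : Fin n) (L F : List (Fin n)) : Set where
    field
      new    : List (Fin n)
      tip    : Fin n
      rest   : List (Fin n)
      shape  : tip ∷ rest ≡ new ++ v ∷ L
      avoids : ∀ {z} → z ∈ new → z ∉ F
      unique : Unique (tip ∷ rest)
      linked : Linked E (tip ∷ rest)
      stuck  : ∀ {w} → E tip w → w ∈ rest ⊎ w ∈ F

    tip-origin : tip ≡ v ⊎ tip ∈ new
    tip-origin with new | shape
    ... | []    | eq = inj₁ (proj₁ (∷-injective eq))
    ... | _ ∷ _ | eq = inj₂ (here (proj₁ (∷-injective eq)))

    rest-nonempty : ∀ {x L′} → L ≡ x ∷ L′ → rest ≢ []
    rest-nonempty L≡ rest≡ =
      singleton≢++∷∷ new (subst₂ (λ r l → tip ∷ r ≡ new ++ v ∷ l) rest≡ L≡ shape)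

  -- k is fuel: each step lengthens a list without repetitions, which has at most n entries
  extend : ∀ k v L F → n ≤ k + length (v ∷ L) → Unique (v ∷ L) → Linked E (v ∷ L) → Extension v L F
  extend k v L F bound uq lk with any? (λ w → T? (S v w) ×-dec ¬? (w ∈? (v ∷ L)) ×-dec ¬? (w ∈? F))
  ... | no none = record
    { new = [] ; tip = v ; rest = L ; shape = refl ; avoids = λ () ; unique = uq ; linked = lk ; stuck = stuck }
    where
    stuck : ∀ {w} → E v w → w ∈ L ⊎ w ∈ F
    stuck {w} e with w ∈? L | w ∈? F
    ... | yes w∈L | _       = inj₁ w∈L
    ... | no  _   | yes w∈F = inj₂ w∈F
    ... | no  w∉L | no  w∉F =
      ⊥-elim (none (w , e , (λ { (here refl) → irreflexive e ; (there w∈L) → w∉L w∈L }) , w∉F))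
  ... | yes (w , e , w∉ , w∉F) with k
  ...   | zero  = ⊥-elim (<-irrefl refl (≤-trans (length≤n (¬Any⇒All¬ _ w∉ ∷ uq)) bound))
  ...   | suc k = record
    { new    = new ∷ʳ w
    ; tip    = tip
    ; rest   = rest
    ; shape  = trans shape (sym (++-assoc new (w ∷ []) (v ∷ L)))
    ; avoids = λ z∈ → [ avoids , (λ { (here refl) → w∉F }) ]′ (∈-++⁻ new z∈)
    ; unique = unique
    ; linked = linked
    ; stuck  = stuck
    }
    where
    open Extension (extend k w (v ∷ L) F (subst (n ≤_) (sym (+-suc k _)) bound)
                           (¬Any⇒All¬ _ w∉ ∷ uq) (symmetric e ∷ lk))

  module _ (connected : ConnectedRel S) (two-leaves : leaves S ≡ 2) where

    private
      Outside : List (Fin n) → Fin n → Set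
      Outside L x = ∃ λ q → E x q × q ∉ L

      outside? : ∀ L x → Dec (Outside L x)
      outside? L x = any? (λ q → T? (S x q) ×-dec ¬? (q ∈? L))

    -- The first vertex p of L with a neighbour q off L would give a third leaf: the tip of the
    -- extension of q ∷ p ∷ … that avoids the part of L before p.
    path-through-two-leaves-is-closed : ∀ {L c a} → Unique L → Linked E L → c ∈ L → a ∈ L → c ≢ a →
      IsLeaf S c → IsLeaf S a → All (¬_ ∘ Outside L) L
    path-through-two-leaves-is-closed {L} {c} {a} uq lk c∈ a∈ c≢a c-leaf a-leaf with cofirst? (outside? L) L
    ... | no ¬first = ¬First⇒All id ¬first
    ... | yes first with toView first
    ...   | first-at {xs = pre} {y = p} pre-closed (q , pq , q∉L) post =
      ⊥-elim ([ (λ tip≡c → tip∉L (subst (_∈ _) (sym tip≡c) c∈))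
              , (λ tip≡a → tip∉L (subst (_∈ _) (sym tip≡a) a∈)) ]′ tip-is-c-or-a)
      where
      open Extension (extend n q (p ∷ post) pre (m≤m+n n _)
        (¬Any⇒All¬ _ (q∉L ∘ ∈-++⁺ʳ pre) ∷ Unique-++⁻ʳ pre uq) (symmetric pq ∷ proj₂ (Linked-split pre lk)))
      tip∉L : tip ∉ pre ++ p ∷ post
      tip∉L tip∈L with tip-origin
      ... | inj₁ tip≡q   = q∉L (subst (_∈ _) tip≡q tip∈L)
      ... | inj₂ tip∈new with ∈-++⁻ pre tip∈L
      ...   | inj₁ tip∈pre  = avoids tip∈new tip∈pre
      ...   | inj₂ tip∈post = Unique-++-disjoint new (subst Unique shape unique) tip∈new (there tip∈post)
      neighbours-on-path : ∀ {w} → E tip w → w ∈ rest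
      neighbours-on-path e with stuck e
      ... | inj₁ w∈rest = w∈rest
      ... | inj₂ w∈pre  = ⊥-elim (All.lookup pre-closed w∈pre (tip , symmetric e , tip∉L))
      tip-is-c-or-a : tip ≡ c ⊎ tip ≡ a
      tip-is-c-or-a = leaf-of-two two-leaves c≢a c-leaf a-leaf
        (stuck-tip-is-leaf rest (rest-nonempty refl) unique linked neighbours-on-path)

    closed-path-is-spanning : ∀ {L c} → c ∈ L → All (¬_ ∘ Outside L) L → ∀ v → v ∈ L
    closed-path-is-spanning {L} {c} c∈ closed v with connected c v
    ... | inj₁ refl      = c∈
    ... | inj₂ (xs , lk) = along xs c∈ lk
      where
      step : ∀ {x y} → x ∈ L → E x y → y ∈ L
      step x∈ e = decidable-stable (_ ∈? L) (λ y∉ → All.lookup closed x∈ (_ , e , y∉))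
      along : ∀ ys {x} → x ∈ L → Linked E (x ∷ ys ∷ʳ v) → v ∈ L
      along []       x∈ (e ∷ _)  = step x∈ e
      along (y ∷ ys) x∈ (e ∷ lk) = along ys (step x∈ e) lk

    two-leaf-tree-is-path : ∃₂ λ c a → SpanningPath E c a × IsLeaf S c × IsLeaf S a × c ≢ a
    two-leaf-tree-is-path = tip , a , (mid , path-unique , covers , path-linked) , tip-leaf , a-leaf , tip≢a
      where
      a      = proj₁ (some-leaf {S = S} two-leaves)
      a-leaf = proj₂ (some-leaf {S = S} two-leaves)
      a′     = proj₁ (leaf-neighbour {S = S} a-leaf)
      aa′    = proj₂ (leaf-neighbour {S = S} a-leaf)
      a′≢a : a′ ≢ a
      a′≢a a′≡a = irreflexive (subst (E a) a′≡a aa′)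
      open Extension (extend n a′ (a ∷ []) [] (m≤m+n n _) ((a′≢a ∷ []) ∷ [] ∷ []) (symmetric aa′ ∷ [-]))
      mid = proj₁ (ends-with new shape)
      path≡ : tip ∷ rest ≡ tip ∷ mid ∷ʳ a
      path≡ = cong (tip ∷_) (proj₂ (ends-with new shape))
      path-unique = subst Unique path≡ unique
      path-linked = subst (Linked E) path≡ linked
      tip≢a : tip ≢ a
      tip≢a tip≡a = Unique.Unique[x∷xs]⇒x∉xs path-unique (∈-++⁺ʳ mid (here tip≡a))
      tip-leaf : IsLeaf S tip
      tip-leaf = stuck-tip-is-leaf rest (rest-nonempty refl) unique linked (λ e → [ id , (λ ()) ]′ (stuck e))
      covers : ∀ v → v ∈ tip ∷ mid ∷ʳ a
      covers = closed-path-is-spanning (here refl)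
        (path-through-two-leaves-is-closed path-unique path-linked (here refl) (there (∈-++⁺ʳ mid (here refl)))
          tip≢a tip-leaf a-leaf)

-- Hamiltonian paths

edge-sym : ∀ {n} (H : Graph n) {u w} → Edge (adj H) u w → Edge (adj H) w u
edge-sym H {u} {w} = subst T (adj-sym H u w)

SpanningPath-reverse : ∀ {n} {R : Fin n → Fin n → Set} → (∀ {u w} → R u w → R w u) →
  ∀ {a b} → SpanningPath R a b → SpanningPath R b a
SpanningPath-reverse {R = R} sym-R {a} {b} (mid , uq , covers , lk) =
  reverse mid , subst Unique eq (Unique-reverse uq) , (λ v → subst (v ∈_) eq (Any.reverse⁺ (covers v))) ,
  subst (Linked R) eq (Linked-reverse sym-R lk)
  where
  eq : reverse (a ∷ mid ∷ʳ b) ≡ b ∷ reverse mid ∷ʳ a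
  eq = trans (reverse-++ (a ∷ mid) (b ∷ [])) (cong (b ∷_) (unfold-reverse a mid))

record PathTree {n} (H : Graph n) (a b : Fin n) (S : Fin n → Fin n → Bool) : Set where
  field
    spanning  : IsSpanningTree H S
    start     : IsLeaf S a
    end       : IsLeaf S b
    inner     : ∀ u → u ≢ a → u ≢ b → degree S u ≡ 2
    start≢end : a ≢ b

  two-leaves : leaves S ≡ 2
  two-leaves = trans (leaves≡count S) (count-pair start≢end (≡⇒≡ᵇ _ 1 start) (≡⇒≡ᵇ _ 1 end)
    (λ u u≢a u≢b leaf → 2≢1 (trans (sym (inner u u≢a u≢b)) (≡ᵇ⇒≡ _ 1 leaf))))
    where
    2≢1 : 2 ≢ 1
    2≢1 ()

  reversed : PathTree H b a S
  reversed = record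
    { spanning = spanning ; start = end ; end = start
    ; inner = λ u u≢b u≢a → inner u u≢a u≢b ; start≢end = start≢end ∘ sym }

HamPath⇒PathTree : ∀ {n} (H : Graph n) {a b} → HamPath H a b → ∃ (PathTree H a b)
HamPath⇒PathTree H {a} {b} (mid , uq , covers , lk) = pathEdges (a ∷ mid ∷ʳ b) , record
  { spanning  = pathEdges-sym , (λ _ _ → pathEdges-sub (edge-sym H) lk) , pathEdges-connected covers ,
                pathEdges-acyclic uq
  ; start     = start
  ; end       = end
  ; inner     = λ u u≢a u≢b → inner′ u≢a u≢b (covers u)
  ; start≢end = λ a≡b → Unique.Unique[x∷xs]⇒x∉xs uq (∈-++⁺ʳ mid (here a≡b))
  }
  where
  open PathDegrees (path-degrees a mid b uq)
  inner′ : ∀ {u} → u ≢ a → u ≢ b → u ∈ a ∷ mid ∷ʳ b → degree (pathEdges (a ∷ mid ∷ʳ b)) u ≡ 2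
  inner′ u≢a u≢b (here u≡a) = ⊥-elim (u≢a u≡a)
  inner′ u≢a u≢b (there u∈) with ∈-++⁻ mid u∈
  ... | inj₁ u∈mid      = inner u∈mid
  ... | inj₂ (here u≡b) = ⊥-elim (u≢b u≡b)

two-leaf-spanning-tree⇒HamPath : ∀ {n} (H : Graph n) {S} → IsSpanningTree H S → leaves S ≡ 2 →
  ∃₂ λ c a → HamPath H c a × IsLeaf S c × IsLeaf S a × c ≢ a
two-leaf-spanning-tree⇒HamPath H {S} (S-sym , S⊆H , connected , acyclic) two-leaves =
  into-H (AcyclicGraph.two-leaf-tree-is-path S (λ {u} {w} → subst T (S-sym u w)) irreflexive acyclic
            connected two-leaves)
  where
  irreflexive : ∀ {u} → ¬ Edge S u u
  irreflexive {u} e = subst T (irref H u) (S⊆H u u e)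
  into-H : (∃₂ λ c a → SpanningPath (Edge S) c a × IsLeaf S c × IsLeaf S a × c ≢ a) →
           ∃₂ λ c a → HamPath H c a × IsLeaf S c × IsLeaf S a × c ≢ a
  into-H (c , a , (mid , uq , covers , lk) , leaves-and-distinct) =
    c , a , (mid , uq , covers , Linked.map (S⊆H _ _) lk) , leaves-and-distinct

lift-spanning-path : ∀ {m} (G : Graph (suc m)) v {xs} → Unique (map (punchIn v) xs) →
  (∀ u → u ≢ v → u ∈ map (punchIn v) xs) → Linked (Edge (adj G)) (map (punchIn v) xs) →
  Unique xs × (∀ u → u ∈ xs) × Linked (Edge (adj (G ─ v))) xs
lift-spanning-path G v {xs} uq covers lk = Unique.map⁻ uq , covers′ , Linked.map⁻ lk
  where
  covers′ : ∀ u → u ∈ xs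
  covers′ u with ∈-map⁻ (punchIn v) (covers (punchIn v u) (punchInᵢ≢i v u))
  ... | y , y∈ , u↦y = subst (_∈ xs) (sym (punchIn-injective v u y u↦y)) y∈

HamPath-minus-start : ∀ {m} (G : Graph (suc m)) → 2 ≤ m → ∀ {a b} → HamPath G a b →
  ∃₂ λ w b′ → punchIn a w ≢ b × punchIn a b′ ≡ b × HamPath (G ─ a) w b′
HamPath-minus-start G 2≤m ([] , _ , covers , _) with covering-length covers
... | s≤s m≤1 = ⊥-elim (≤⇒≯ m≤1 2≤m)
HamPath-minus-start G 2≤m {a} {b} (w ∷ mid , uq@(_ ∷ uq′) , covers , _ ∷ lk) =
  punchOut a≢w , punchOut a≢b , w≢b ∘ trans (sym (punchIn-punchOut a≢w)) , punchIn-punchOut a≢b ,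
  mid′ , lift-spanning-path G a (subst Unique (sym lifted) uq′) covers′ (subst (Linked _) (sym lifted) lk)
  where
  a∉ : a ∉ w ∷ mid ∷ʳ b
  a∉ = Unique.Unique[x∷xs]⇒x∉xs uq
  b∈ : b ∈ mid ∷ʳ b
  b∈ = ∈-++⁺ʳ mid (here refl)
  a≢w : a ≢ w
  a≢w = a∉ ∘ here
  a≢b : a ≢ b
  a≢b refl = a∉ (there b∈)
  w≢b : w ≢ b
  w≢b refl = Unique.Unique[x∷xs]⇒x∉xs uq′ b∈
  mid-avoids-a = ∉⇒map-punchIn a mid (a∉ ∘ there ∘ ∈-++⁺ˡ)
  mid′ = proj₁ mid-avoids-a
  lifted : map (punchIn a) (punchOut a≢w ∷ mid′ ∷ʳ punchOut a≢b) ≡ w ∷ mid ∷ʳ b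
  lifted = cong₂ _∷_ (punchIn-punchOut a≢w) (trans (map-++ (punchIn a) mid′ (punchOut a≢b ∷ []))
             (cong₂ _++_ (proj₂ mid-avoids-a) (cong (_∷ []) (punchIn-punchOut a≢b))))
  covers′ : ∀ u → u ≢ a → u ∈ map (punchIn a) (punchOut a≢w ∷ mid′ ∷ʳ punchOut a≢b)
  covers′ u u≢a with covers u
  ... | here u≡a = ⊥-elim (u≢a u≡a)
  ... | there u∈ = subst (u ∈_) (sym lifted) u∈

lists≤ : ∀ {n} → ℕ → List (List (Fin n))
lists≤     zero    = [] ∷ []
lists≤ {n} (suc k) = [] ∷ concatMap (λ x → map (x ∷_) (lists≤ k)) (allFin n)

∈-lists≤ : ∀ {n} k (xs : List (Fin n)) → length xs ≤ k → xs ∈ lists≤ k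
∈-lists≤ zero    []       _         = here refl
∈-lists≤ (suc k) []       _         = here refl
∈-lists≤ (suc k) (x ∷ xs) (s≤s len) =
  there (∈-concat⁺′ (∈-map⁺ (x ∷_) (∈-lists≤ k xs len))
                    (∈-map⁺ (λ y → map (y ∷_) (lists≤ k)) (∈-allFin x)))

HamPath? : ∀ {n} (H : Graph n) a b → Dec (HamPath H a b)
HamPath? {n} H a b = from-candidates (Any.any? valid? (lists≤ n))
  where
  Valid : List (Fin n) → Set
  Valid mid = Unique (a ∷ mid ∷ʳ b) × (∀ v → v ∈ a ∷ mid ∷ʳ b) × Linked (Edge (adj H)) (a ∷ mid ∷ʳ b)
  valid? : ∀ mid → Dec (Valid mid)
  valid? mid = unique? (a ∷ mid ∷ʳ b) ×-dec all? (λ v → v ∈? (a ∷ mid ∷ʳ b))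
               ×-dec linked? (λ u w → T? (adj H u w)) (a ∷ mid ∷ʳ b)
  short : ∀ mid → Unique (a ∷ mid ∷ʳ b) → length mid ≤ n
  short mid uq = ≤-trans (≤-trans (m≤m+n (length mid) 1) (≤-reflexive (sym (length-++ mid))))
                         (≤-trans (n≤1+n _) (length≤n uq))
  from-candidates : Dec (Any Valid (lists≤ n)) → Dec (HamPath H a b)
  from-candidates (yes found) = yes (Any.satisfied found)
  from-candidates (no  none)  = no λ (mid , valid) → none (lose (∈-lists≤ n mid (short mid (proj₁ valid))) valid)

-- ml-subgraphs and the cost of deleting a vertex

module _ {n} (H : Graph n) (ml₂ : MLis2 H) where

  MLSub⇒two-leaf-tree : ∀ {S} → IsMLSub H S → IsSpanningTree H S × leaves S ≡ 2
  MLSub⇒two-leaf-tree (inj₁ ham-cycle) = ⊥-elim (proj₁ ml₂ (_ , ham-cycle))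
  MLSub⇒two-leaf-tree {S} (inj₂ (_ , tree , minimal)) =
    let T₀ , tree₀ , two₀ = proj₁ (proj₂ ml₂)
    in  tree , ≤-antisym (subst (leaves S ≤_) two₀ (minimal T₀ tree₀)) (proj₂ (proj₂ ml₂) S tree)

  two-leaf-tree⇒MLSub : ∀ {S} → IsSpanningTree H S → leaves S ≡ 2 → IsMLSub H S
  two-leaf-tree⇒MLSub tree two =
    inj₂ (proj₁ ml₂ , tree , λ T₁ tree₁ →
      subst (_≤ leaves T₁) (sym two) (proj₂ (proj₂ ml₂) T₁ tree₁))

  some-MLSub : ∃ (IsMLSub H)
  some-MLSub = let T₀ , tree₀ , two₀ = proj₁ (proj₂ ml₂) in T₀ , two-leaf-tree⇒MLSub tree₀ two₀

not-≡ᵇ⇔≢ : ∀ d d′ → T (not (d ≡ᵇ d′)) ⇔ d ≢ d′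
not-≡ᵇ⇔≢ d d′ with d ≡ᵇ d′ in eq
... | true  = mk⇔ (λ ()) (λ d≢d′ → d≢d′ (≡ᵇ⇒≡ d d′ (subst T (sym eq) _)))
... | false = mk⇔ (λ _ d≡d′ → subst T eq (≡⇒≡ᵇ d d′ d≡d′)) _

module _ {m} (S : Fin (suc m) → Fin (suc m) → Bool) (v : Fin (suc m)) (Sv : Fin m → Fin m → Bool) where

  changed : Fin m → Bool
  changed u = not (degree S (punchIn v u) ≡ᵇ degree Sv u)

  changed⇔≢ : ∀ u → T (changed u) ⇔ degree S (punchIn v u) ≢ degree Sv u
  changed⇔≢ u = not-≡ᵇ⇔≢ (degree S (punchIn v u)) (degree Sv u)

  τ≡count : τ S v Sv ≡ count changed
  τ≡count = trans (cong sum (map-cong (λ u → flip-bit (degree S (punchIn v u) ≡ᵇ degree Sv u)) (allFin m)))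
                  (sum-bits≡count changed)
    where
    flip-bit : ∀ b → (if b then 0 else 1) ≡ bit (not b)
    flip-bit true  = refl
    flip-bit false = refl

  τ≡0⇒same-degrees : τ S v Sv ≡ 0 → ∀ u → degree S (punchIn v u) ≡ degree Sv u
  τ≡0⇒same-degrees τ≡0 u = decidable-stable (degree S (punchIn v u) ≟ℕ degree Sv u)
    (count≡0 (trans (sym τ≡count) τ≡0) u ∘ Equivalence.from (changed⇔≢ u))

  same-degrees⇒τ≡0 : (∀ u → degree S (punchIn v u) ≡ degree Sv u) → τ S v Sv ≡ 0
  same-degrees⇒τ≡0 same =
    trans τ≡count (count-false {f = changed} (λ u ch → Equivalence.to (changed⇔≢ u) ch (same u)))

  one-change⇒τ≡1 : ∀ {w} → degree S (punchIn v w) ≢ degree Sv w →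
    (∀ u → u ≢ w → degree S (punchIn v u) ≡ degree Sv u) → τ S v Sv ≡ 1
  one-change⇒τ≡1 {w} differs same = trans τ≡count (count-point {f = changed}
    (Equivalence.from (changed⇔≢ w) differs) (λ u u≢w ch → Equivalence.to (changed⇔≢ u) ch (same u u≢w)))

  leaf-before leaf-after : Fin m → Bool
  leaf-before u = degree S (punchIn v u) ≡ᵇ 1
  leaf-after  u = degree Sv u ≡ᵇ 1

  leaves-before : leaves S ≡ bit (degree S v ≡ᵇ 1) + count leaf-before
  leaves-before = trans (leaves≡count S) (count-punchIn (λ u → degree S u ≡ᵇ 1) v)

  τ-positive-at-leaf : leaves S ≡ 2 → IsLeaf S v → leaves Sv ≡ 2 → 1 ≤ τ S v Sv
  τ-positive-at-leaf two v-leaf two-v = n≢0⇒n>0 λ τ≡0 → 3≢2 (begin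
    3                                          ≡⟨ cong suc two-v ⟨
    suc (leaves Sv)                            ≡⟨ cong suc (leaves≡count Sv) ⟩
    suc (count leaf-after)                     ≡⟨ cong₂ _+_ (bit-true (≡⇒≡ᵇ _ 1 v-leaf))
                                                    (count-cong (cong (_≡ᵇ 1) ∘ τ≡0⇒same-degrees τ≡0)) ⟨
    bit (degree S v ≡ᵇ 1) + count leaf-before  ≡⟨ leaves-before ⟨
    leaves S                                   ≡⟨ two ⟩
    2                                          ∎)
    where
    open ≡-Reasoning
    3≢2 : 3 ≢ 2
    3≢2 ()

module _ {m} {G : Graph (suc m)} {a b : Fin (suc m)} {S : Fin (suc m) → Fin (suc m) → Bool}
  (pt : PathTree G a b S) where
  open PathTree

  start-deletion-costs-1 : 2 ≤ m → HamPath G a b → MLis2 (G ─ a) →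
    ∃ λ Sv → IsMLSub (G ─ a) Sv × τ S a Sv ≡ 1
  start-deletion-costs-1 2≤m hp ml with HamPath-minus-start G 2≤m hp
  ... | w , b′ , w≢b , b′↦b , hpv with HamPath⇒PathTree (G ─ a) hpv
  ...   | Sv , ptv =
    Sv , two-leaf-tree⇒MLSub (G ─ a) ml (spanning ptv) (two-leaves ptv) , one-change⇒τ≡1 S a Sv differs same
    where
    differs : degree S (punchIn a w) ≢ degree Sv w
    differs eq = 2≢1 (trans (sym (inner pt _ (punchInᵢ≢i a w) w≢b)) (trans eq (start ptv)))
      where
      2≢1 : 2 ≢ 1
      2≢1 ()
    same : ∀ u → u ≢ w → degree S (punchIn a u) ≡ degree Sv u
    same u u≢w with u ≟ b′
    ... | yes refl = trans (cong (degree S) b′↦b) (trans (end pt) (sym (end ptv)))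
    ... | no u≢b′  = trans (inner pt _ (punchInᵢ≢i a u) (punchIn-≢ a b′↦b u≢b′))
                           (sym (inner ptv u u≢w u≢b′))

  same-ends⇒τ≡0 : ∀ {v a′ b′ Sv} → punchIn v a′ ≡ a → punchIn v b′ ≡ b → PathTree (G ─ v) a′ b′ Sv →
    τ S v Sv ≡ 0
  same-ends⇒τ≡0 {v} {a′} {b′} {Sv} a′↦a b′↦b ptv = same-degrees⇒τ≡0 S v Sv same
    where
    same : ∀ u → degree S (punchIn v u) ≡ degree Sv u
    same u with u ≟ a′ | u ≟ b′
    ... | yes refl | _        = trans (cong (degree S) a′↦a) (trans (start pt) (sym (start ptv)))
    ... | no _     | yes refl = trans (cong (degree S) b′↦b) (trans (end pt) (sym (end ptv)))
    ... | no u≢a′  | no u≢b′  =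
      trans (inner pt _ (punchIn-≢ v a′↦a u≢a′) (punchIn-≢ v b′↦b u≢b′)) (sym (inner ptv u u≢a′ u≢b′))

module _ {m} {G : Graph (suc m)} {S : Fin (suc m) → Fin (suc m) → Bool} {c a : Fin (suc m)}
  (two : leaves S ≡ 2) (c-leaf : IsLeaf S c) (a-leaf : IsLeaf S a) (c≢a : c ≢ a) where

  cheap-deletion-keeps-ends : ∀ {x c′ a′ Sv} → punchIn x c′ ≡ c → punchIn x a′ ≡ a →
    IsSpanningTree (G ─ x) Sv → leaves Sv ≡ 2 → τ S x Sv ≤ 1 → HamPath (G ─ x) c′ a′
  cheap-deletion-keeps-ends {x} {c′} {a′} {Sv} c′↦c a′↦a tree two-v τ≤1 =
    ends (two-leaf-spanning-tree⇒HamPath (G ─ x) tree two-v)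
    where
    x-not-leaf : ¬ T (degree S x ≡ᵇ 1)
    x-not-leaf x-leaf with leaf-of-two two c≢a c-leaf a-leaf (≡ᵇ⇒≡ _ 1 x-leaf)
    ... | inj₁ refl = punchInᵢ≢i x c′ c′↦c
    ... | inj₂ refl = punchInᵢ≢i x a′ a′↦a
    same-count : count (leaf-before S x Sv) ≡ count (leaf-after S x Sv)
    same-count = begin
      count (leaf-before S x Sv)                          ≡⟨ cong (_+ count (leaf-before S x Sv)) (bit-false x-not-leaf) ⟨
      bit (degree S x ≡ᵇ 1) + count (leaf-before S x Sv)  ≡⟨ leaves-before S x Sv ⟨
      leaves S                                            ≡⟨ trans two (sym two-v) ⟩
      leaves Sv                                           ≡⟨ leaves≡count Sv ⟩
      count (leaf-after S x Sv)                           ∎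
      where open ≡-Reasoning
    same-leaves : ∀ u → leaf-before S x Sv u ≡ leaf-after S x Sv u
    same-leaves = same-count-one-difference⇒≗ same-count (subst (_≤ 1) (τ≡count S x Sv) τ≤1)
      (λ u differ → Equivalence.from (changed⇔≢ S x Sv u) (differ ∘ cong (_≡ᵇ 1)))
    end-of : ∀ {u} → IsLeaf Sv u → punchIn x u ≡ c ⊎ punchIn x u ≡ a
    end-of {u} u-leaf = leaf-of-two two c≢a c-leaf a-leaf
      (≡ᵇ⇒≡ _ 1 (subst T (sym (same-leaves u)) (≡⇒≡ᵇ _ 1 u-leaf)))
    ends : (∃₂ λ c″ d″ → HamPath (G ─ x) c″ d″ × IsLeaf Sv c″ × IsLeaf Sv d″ × c″ ≢ d″) →
      HamPath (G ─ x) c′ a′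
    ends (c″ , d″ , hp , c″-leaf , d″-leaf , c″≢d″) with end-of c″-leaf | end-of d″-leaf
    ... | inj₁ c″↦c | inj₂ d″↦a =
      subst₂ (HamPath (G ─ x)) (punchIn-cancel x c″↦c c′↦c) (punchIn-cancel x d″↦a a′↦a) hp
    ... | inj₂ c″↦a | inj₁ d″↦c =
      subst₂ (HamPath (G ─ x)) (punchIn-cancel x d″↦c c′↦c) (punchIn-cancel x c″↦a a′↦a)
        (SpanningPath-reverse (edge-sym (G ─ x)) hp)
    ... | inj₁ c″↦c | inj₁ d″↦c = ⊥-elim (c″≢d″ (punchIn-cancel x c″↦c d″↦c))
    ... | inj₂ c″↦a | inj₂ d″↦a = ⊥-elim (c″≢d″ (punchIn-cancel x c″↦a d″↦a))

-- Fault cost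

¬¬-minimum : ∀ (P : ℕ → Set) {k} → P k → ¬ ¬ ∃ (IsMinOf P)
¬¬-minimum P {k} pk no-minimum = <-rec (λ j → ¬ P j) below k pk
  where
  below : ∀ j → (∀ {i} → i < j → ¬ P i) → ¬ P j
  below j smaller pj = no-minimum (j , pj , λ i pi → decidable-stable (j ≤? i) (λ j≰i → smaller (≰⇒> j≰i) pi))

module _ {m} (G : Graph (suc m)) (S : Fin (suc m) → Fin (suc m) → Bool) (v : Fin (suc m)) where

  ¬¬-MinTau : MLis2 (G ─ v) → ¬ ¬ ∃ (MinTau G S v)
  ¬¬-MinTau ml = let Sv , ml-Sv = some-MLSub (G ─ v) ml in ¬¬-minimum _ (Sv , ml-Sv , refl)

  MinTau-≤ : ∀ {j Sv} → MinTau G S v j → IsMLSub (G ─ v) Sv → j ≤ τ S v Sv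
  MinTau-≤ (_ , minimal) ml = minimal _ (_ , ml , refl)

PhiS-positive : ∀ {m} (G : Graph (suc m)) → TwoLeafStable G → ∀ {S j} → IsMLSub G S → PhiS G S j → 1 ≤ j
PhiS-positive G (mlG , mlv) {S} {j} mlS (_ , maximal) = decidable-stable (1 ≤? j) λ j<1 →
  ¬¬-MinTau G S v (mlv v) λ (k , min) → j<1 (≤-trans (1≤k min) (maximal k (v , min)))
  where
  two : leaves S ≡ 2
  two = proj₂ (MLSub⇒two-leaf-tree G mlG mlS)
  v = proj₁ (some-leaf {S = S} two)
  1≤k : ∀ {k} → MinTau G S v k → 1 ≤ k
  1≤k ((Sv , ml-Sv , τ≡k) , _) = subst (1 ≤_) τ≡k
    (τ-positive-at-leaf S v Sv two (proj₂ (some-leaf {S = S} two))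
      (proj₂ (MLSub⇒two-leaf-tree (G ─ v) (mlv v) ml-Sv)))

RobustHamPath : ∀ {m} → Graph (suc m) → Fin (suc m) → Fin (suc m) → Set
RobustHamPath G a₁ a₂ = HamPath G a₁ a₂
  × (∀ x → x ≢ a₁ → x ≢ a₂ →
       ∃[ a₁′ ] ∃[ a₂′ ] (punchIn x a₁′ ≡ a₁ × punchIn x a₂′ ≡ a₂ × HamPath (G ─ x) a₁′ a₂′))

RobustHamPath⇒FaultCost1 : ∀ {m} (G : Graph (suc m)) → TwoConnected G → TwoLeafStable G →
  ∀ {a₁ a₂} → RobustHamPath G a₁ a₂ → FaultCost G 1
RobustHamPath⇒FaultCost1 G (2≤m , _) stable@(mlG , mlv) {a₁} {a₂} (hp , survives) =
  (S , two-leaf-tree⇒MLSub G mlG (spanning pt) (two-leaves pt) , (a₁ , minimum-at-a₁) , maximal) ,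
  λ j (_ , ml-S′ , φ) → PhiS-positive G stable ml-S′ φ
  where
  open PathTree
  S  = proj₁ (HamPath⇒PathTree G hp)
  pt = proj₂ (HamPath⇒PathTree G hp)
  cheap : ∀ v → ∃ λ Sv → IsMLSub (G ─ v) Sv × τ S v Sv ≤ 1
  cheap v with v ≟ a₁ | v ≟ a₂
  ... | yes refl | _ =
    let Sv , ml , τ≡1 = start-deletion-costs-1 pt 2≤m hp (mlv v) in Sv , ml , ≤-reflexive τ≡1
  ... | no _ | yes refl =
    let Sv , ml , τ≡1 = start-deletion-costs-1 (reversed pt) 2≤m (SpanningPath-reverse (edge-sym G) hp) (mlv v)
    in  Sv , ml , ≤-reflexive τ≡1
  ... | no v≢a₁ | no v≢a₂ =
    let a₁′ , a₂′ , a₁′↦a₁ , a₂′↦a₂ , hpv = survives v v≢a₁ v≢a₂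
        Sv , ptv = HamPath⇒PathTree (G ─ v) hpv
    in  Sv , two-leaf-tree⇒MLSub (G ─ v) (mlv v) (spanning ptv) (two-leaves ptv) ,
        subst (_≤ 1) (sym (same-ends⇒τ≡0 pt a₁′↦a₁ a₂′↦a₂ ptv)) z≤n
  maximal : ∀ j → ∃ (λ v → MinTau G S v j) → j ≤ 1
  maximal j (v , min) = let _ , ml , τ≤1 = cheap v in ≤-trans (MinTau-≤ G S v min ml) τ≤1
  minimum-at-a₁ : MinTau G S a₁ 1
  minimum-at-a₁ = start-deletion-costs-1 pt 2≤m hp (mlv a₁) , λ j (Sv , ml , τ≡j) → subst (1 ≤_) τ≡j
    (τ-positive-at-leaf S a₁ Sv (two-leaves pt) (start pt)
      (proj₂ (MLSub⇒two-leaf-tree (G ─ a₁) (mlv a₁) ml)))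

FaultCost1⇒RobustHamPath : ∀ {m} (G : Graph (suc m)) → TwoLeafStable G → FaultCost G 1 → ∃₂ (RobustHamPath G)
FaultCost1⇒RobustHamPath G (mlG , mlv) ((S , mlS , (_ , maximal)) , _) =
  robust (two-leaf-spanning-tree⇒HamPath G (proj₁ tree) (proj₂ tree))
  where
  tree = MLSub⇒two-leaf-tree G mlG mlS
  robust : (∃₂ λ c a → HamPath G c a × IsLeaf S c × IsLeaf S a × c ≢ a) → ∃₂ (RobustHamPath G)
  robust (c , a , hp , c-leaf , a-leaf , c≢a) = c , a , hp , survives
    where
    survives : ∀ x → x ≢ c → x ≢ a →
      ∃[ c′ ] ∃[ a′ ] (punchIn x c′ ≡ c × punchIn x a′ ≡ a × HamPath (G ─ x) c′ a′)
    survives x x≢c x≢a = punchOut x≢c , punchOut x≢a , punchIn-punchOut x≢c , punchIn-punchOut x≢a ,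
      decidable-stable (HamPath? (G ─ x) (punchOut x≢c) (punchOut x≢a)) λ no-path →
        ¬¬-MinTau G S x (mlv x) λ (k , min@((Sv , ml-Sv , τ≡k) , _)) →
          let tree-v = MLSub⇒two-leaf-tree (G ─ x) (mlv x) ml-Sv
          in  no-path (cheap-deletion-keeps-ends {G = G} (proj₂ tree) c-leaf a-leaf c≢a
                (punchIn-punchOut x≢c) (punchIn-punchOut x≢a) (proj₁ tree-v) (proj₂ tree-v)
                (subst (_≤ 1) (sym τ≡k) (maximal k (x , min))))

claim1 : ∀ {m} (G : Graph (suc m)) → TwoConnected G → TwoLeafStable G →
    ( FaultCost G 1
    ⇔ (∃[ a₁ ] ∃[ a₂ ] (HamPath G a₁ a₂
         × (∀ x → x ≢ a₁ → x ≢ a₂ →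
              ∃[ a₁' ] ∃[ a₂' ] (punchIn x a₁' ≡ a₁ × punchIn x a₂' ≡ a₂ × HamPath (G ─ x) a₁' a₂')))))
claim1 G two-connected stable = mk⇔
  (FaultCost1⇒RobustHamPath G stable)
  (λ (_ , _ , robust) → RobustHamPath⇒FaultCost1 G two-connected stable robust)
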